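{- Let $\ell$ be an odd prime and $n$ a positive integer. For each odd integer $i$ with $0<i\le \ell^n$ put $$c_i=\frac{2\ell^n}{\ell^n+i}\binom{(\ell^n+i)/2}{(\ell^n-i)/2},$$ which is, up to sign, the coefficient of $x^i$ in $T_\ell^n(x)$. Then for every integer $m$ with $0\le m\le n$ and every odd integer $i$ with $0<i\le\ell^m$, we have $\nu_\ell(c_i)\ge n-m$, with equality only if $i=\ell^m$. Furthermore, the lower convex hull of the points $\{(i,\nu_\ell(c_i)) : i \text{ odd},\ 1\le i\le \ell^n\}$ is $S_1+S_2+\cdots+S_n$, where $S_m$ denotes the segment with endpoints $(\ell^{m-1},n-m+1)$ and $(\ell^m,n-m)$.
   Context: $T_d(x)$ is the Chebyshev polynomial of the first kind of degree $d$, given explicitly by $T_d(x)=\sum_{k=0}^{\lfloor d/2\rfloor}(-1)^k\frac{d}{d-k}\binom{d-k}{k}x^{d-2k}$; $T_\ell^n$ is the $n$-fold composition of $T_\ell$, equal to $T_{\ell^n}$. $\nu_\ell$ is the $\ell$-adic valuation. This lower convex hull is the $\ell$-adic Newton polygon of $T_\ell^n(x)$ (whose coefficients of $x^i$ vanish for even $i$); $S_1+\cdots+S_n$ denotes the polygonal line formed by the consecutive segments $S_1,\dots,S_n$. -}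

module Defs where

open import Data.Nat using (ℕ; zero; suc; _+_; _*_; _∸_; _^_; _≤_; _<_)
open import Data.Nat.DivMod using (_/_)
open import Data.Nat.Divisibility using (_∣_; _∣?_; divides)
open import Data.Nat.Combinatorics using (_C_)
open import Data.Product using (Σ; _×_; _,_)
open import Data.Integer as ℤ using (ℤ; +_)
open import Relation.Binary.PropositionalEquality using (_≡_)
open import Relation.Nullary using (yes; no)

Odd : ℕ → Set
Odd i = Σ ℕ λ j → i ≡ 2 * j + 1

-- natural-number division (divisor 0 gives 0; only used with nonzero divisors)
div : ℕ → ℕ → ℕ
div m zero    = 0
div m (suc d) = m / suc d

-- ℓ-adic valuation of a natural number (ν ℓ 0 = 0 by convention; only used
-- on nonzero arguments). Fuel = the number itself suffices for ℓ ≥ 2.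
νAux : ℕ → ℕ → ℕ → ℕ
νAux zero     ℓ k = 0
νAux (suc f)  ℓ k with ℓ ∣? k
... | yes (divides q _) = suc (νAux f ℓ q)
... | no  _             = 0

ν : ℕ → ℕ → ℕ
ν ℓ k = νAux k ℓ k

-- c_i = 2ℓ^n/(ℓ^n+i) * binom((ℓ^n+i)/2, (ℓ^n-i)/2)  (an integer; exact division)
c : (ℓ n i : ℕ) → ℕ
c ℓ n i = div (2 * ℓ ^ n * (((ℓ ^ n + i) / 2) C ((ℓ ^ n ∸ i) / 2))) (ℓ ^ n + i)

-- the point (x , y) lies on or above the line through (x₁ , y₁) and (x₂ , y₂)
-- (x₁ < x₂):  (y - y₁)(x₂ - x₁) ≥ (y₂ - y₁)(x - x₁)
AboveLine : (x₁ y₁ x₂ y₂ x y : ℕ) → Set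
AboveLine x₁ y₁ x₂ y₂ x y =
  ((+ y₂) ℤ.- (+ y₁)) ℤ.* ((+ x) ℤ.- (+ x₁)) ℤ.≤ ((+ y) ℤ.- (+ y₁)) ℤ.* ((+ x₂) ℤ.- (+ x₁))

-- The lower convex hull of the finite point set { (i , f i) : D i } is the
-- polygonal line with vertices (vx 0 , vy 0), …, (vx k , vy k):
--  * the vertex x-coordinates are strictly increasing,
--  * every vertex is one of the points,
--  * the first/last vertex is the leftmost/rightmost point,
--  * every point lies on or above the line supporting every edge.
record IsLowerHull (D : ℕ → Set) (f : ℕ → ℕ) (k : ℕ) (vx vy : ℕ → ℕ) : Set where
  field
    increasing : ∀ j → j < k → vx j < vx (suc j)
    vertexInD  : ∀ j → j ≤ k → D (vx j)
    vertexOn   : ∀ j → j ≤ k → f (vx j) ≡ vy j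
    leftmost   : ∀ i → D i → vx 0 ≤ i
    rightmost  : ∀ i → D i → i ≤ vx k
    above      : ∀ j → j < k → ∀ i → D i →
                 AboveLine (vx j) (vy j) (vx (suc j)) (vy (suc j)) i (f i)

-- Writing ℓⁿ = 2b + i, the coefficient satisfies cᵢ · i = ℓⁿ · C(b + i − 1, b), so
-- ν(cᵢ) = n − ν(i) + ν(C(b + i − 1, b)) ≥ n − ν(i). For i ≤ ℓᵐ this is at least n − m, and
-- equality forces ℓᵐ ∣ i, i.e. i = ℓᵐ. At i = ℓʲ we have ℓʲ ∣ b, and the absorption identity
-- (s + 1) C(b + s + 1, b) = (b + s + 1) C(b + s, b), together with ν(b + s + 1) = ν(s + 1) for
-- s + 1 < ℓʲ, shows that ℓ does not divide the binomial, so the vertex (ℓʲ, n − j) is attained.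
-- Any point with ν(i) = t has i ≥ ℓᵗ and ν(cᵢ) ≥ n − t, which by Bernoulli's inequality
-- ℓᵈ ≥ 1 + d(ℓ − 1) puts it on or above every segment.

module Submission where

open import Data.Empty using (⊥-elim)
import Data.Integer as ℤ
import Data.Integer.Properties as ℤₚ
open import Data.Integer.Tactic.RingSolver using () renaming (solve-∀ to ℤ-solve-∀)
open import Data.Nat
open import Data.Nat.Combinatorics using (_C_; nCk≡n!/k![n-k]!; k![n∸k]!∣n!; nCn≡1; nCk+nC[k+1]≡[n+1]C[k+1])
open import Data.Nat.DivMod using (_/_; m*n/n≡m; m/n*n≡m)
open import Data.Nat.Divisibility
open import Data.Nat.Primality using (Prime; euclidsLemma; prime⇒nonTrivial)
open import Data.Nat.Properties
open import Data.Nat.Tactic.RingSolver using (solve-∀)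
open import Data.Product as Σ using (Σ; _×_; _,_)
open import Data.Sum using (inj₁; inj₂)
open import Relation.Binary.Definitions using (tri<; tri≈; tri>)
open import Relation.Binary.PropositionalEquality
open import Relation.Nullary using (¬_; yes; no)

open import Defs

nCk*k!*[n∸k]!≡n! : ∀ {n k} → k ≤ n → (n C k) * (k ! * (n ∸ k) !) ≡ n !
nCk*k!*[n∸k]!≡n! {n} {k} k≤n =
  trans (cong (_* (k ! * (n ∸ k) !)) (nCk≡n!/k![n-k]! k≤n)) (m/n*n≡m (k![n∸k]!∣n! k≤n))
  where instance _ = k !* (n ∸ k) !≢0

binom : ℕ → ℕ → ℕ
binom zero    y       = 1
binom (suc x) zero    = 1
binom (suc x) (suc y) = binom x (suc y) + binom (suc x) y

[y+x]Cy≡binom : ∀ x y → (y + x) C y ≡ binom x y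
[y+x]Cy≡binom zero    y       = trans (cong (_C y) (+-identityʳ y)) (nCn≡1 y)
[y+x]Cy≡binom (suc x) zero    = refl
[y+x]Cy≡binom (suc x) (suc y) = begin
  suc (y + suc x) C suc y                 ≡⟨ nCk+nC[k+1]≡[n+1]C[k+1] (y + suc x) y ⟨
  (y + suc x) C y + (y + suc x) C suc y   ≡⟨ +-comm ((y + suc x) C y) _ ⟩
  (y + suc x) C suc y + (y + suc x) C y   ≡⟨ cong₂ _+_ (cong (_C suc y) (+-suc y x)) refl ⟩
  suc (y + x) C suc y + (y + suc x) C y   ≡⟨ cong₂ _+_ ([y+x]Cy≡binom x (suc y)) ([y+x]Cy≡binom (suc x) y) ⟩
  binom x (suc y) + binom (suc x) y       ∎
  where open ≡-Reasoning

binom>0 : ∀ x y → binom x y > 0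
binom>0 zero    y       = z<s
binom>0 (suc x) zero    = z<s
binom>0 (suc x) (suc y) = ≤-trans (binom>0 x (suc y)) (m≤m+n _ _)

binom-nonZero : ∀ x y → NonZero (binom x y)
binom-nonZero x y = >-nonZero (binom>0 x y)

binom*y!*x!≡[y+x]! : ∀ x y → binom x y * (y ! * x !) ≡ (y + x) !
binom*y!*x!≡[y+x]! x y = begin
  binom x y * (y ! * x !)                ≡⟨ cong₂ (λ b z → b * (y ! * z !)) ([y+x]Cy≡binom x y) (m+n∸m≡n y x) ⟨
  ((y + x) C y) * (y ! * (y + x ∸ y) !)  ≡⟨ nCk*k!*[n∸k]!≡n! (m≤m+n y x) ⟩
  (y + x) !                              ∎
  where open ≡-Reasoning

binom-absorbˡ : ∀ x y → suc x * binom (suc x) y ≡ suc (y + x) * binom x y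
binom-absorbˡ x y = *-cancelʳ-≡ (suc x * binom (suc x) y) (suc (y + x) * binom x y) (y ! * x !) (begin
  suc x * binom (suc x) y * (y ! * x !)   ≡⟨ reorder (suc x) (binom (suc x) y) (y !) (x !) ⟩
  binom (suc x) y * (y ! * (suc x * x !)) ≡⟨ binom*y!*x!≡[y+x]! (suc x) y ⟩
  (y + suc x) !                           ≡⟨ cong _! (+-suc y x) ⟩
  suc (y + x) * (y + x) !                 ≡⟨ cong (suc (y + x) *_) (binom*y!*x!≡[y+x]! x y) ⟨
  suc (y + x) * (binom x y * (y ! * x !)) ≡⟨ *-assoc (suc (y + x)) (binom x y) (y ! * x !) ⟨
  suc (y + x) * binom x y * (y ! * x !)   ∎)
  where
  open ≡-Reasoning
  instance _ = m*n≢0 (y !) (x !) {{y !≢0}} {{x !≢0}}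
  reorder : ∀ a b c d → a * b * (c * d) ≡ b * (c * (a * d))
  reorder = solve-∀

binom-absorbʳ : ∀ x y → suc y * binom x (suc y) ≡ suc (y + x) * binom x y
binom-absorbʳ x y = *-cancelʳ-≡ (suc y * binom x (suc y)) (suc (y + x) * binom x y) (y ! * x !) (begin
  suc y * binom x (suc y) * (y ! * x !)   ≡⟨ reorder (suc y) (binom x (suc y)) (y !) (x !) ⟩
  binom x (suc y) * ((suc y * y !) * x !) ≡⟨ binom*y!*x!≡[y+x]! x (suc y) ⟩
  suc (y + x) * (y + x) !                 ≡⟨ cong (suc (y + x) *_) (binom*y!*x!≡[y+x]! x y) ⟨
  suc (y + x) * (binom x y * (y ! * x !)) ≡⟨ *-assoc (suc (y + x)) (binom x y) (y ! * x !) ⟨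
  suc (y + x) * binom x y * (y ! * x !)   ∎)
  where
  open ≡-Reasoning
  instance _ = m*n≢0 (y !) (x !) {{y !≢0}} {{x !≢0}}
  reorder : ∀ a b c d → a * b * (c * d) ≡ b * ((a * c) * d)
  reorder = solve-∀

coeff : ℕ → ℕ → ℕ
coeff N i = div (2 * N * (((N + i) / 2) C ((N ∸ i) / 2))) (N + i)

div-*-cancelʳ : ∀ m d .{{_ : NonZero d}} → div (m * d) d ≡ m
div-*-cancelʳ m (suc d) = m*n/n≡m m (suc d)

b+i∣[2b+i]*binom : ∀ b i → b + i ∣ (2 * b + i) * binom i b
b+i∣[2b+i]*binom zero    zero    = 0 ∣0
b+i∣[2b+i]*binom zero    (suc i) = m∣m*n 1
b+i∣[2b+i]*binom (suc b) i       = divides (binom i (suc b) + binom i b) (begin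
  (2 * suc b + i) * binom i (suc b)                         ≡⟨ split b i (binom i (suc b)) ⟩
  (suc b + i) * binom i (suc b) + suc b * binom i (suc b)   ≡⟨ cong ((suc b + i) * binom i (suc b) +_) (binom-absorbʳ i b) ⟩
  (suc b + i) * binom i (suc b) + (suc b + i) * binom i b   ≡⟨ *-distribˡ-+ (suc b + i) (binom i (suc b)) (binom i b) ⟨
  (suc b + i) * (binom i (suc b) + binom i b)               ≡⟨ *-comm (suc b + i) _ ⟩
  (binom i (suc b) + binom i b) * (suc b + i)               ∎)
  where
  open ≡-Reasoning
  split : ∀ b i B → (2 * suc b + i) * B ≡ (suc b + i) * B + suc b * B
  split = solve-∀

coeff*[b+i]≡N*binom : ∀ b i → coeff (2 * b + suc i) (suc i) * (b + suc i) ≡ (2 * b + suc i) * binom (suc i) b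
coeff*[b+i]≡N*binom b i = trans (cong (_* a) coeff≡q) (sym N*B≡q*a)
  where
  open ≡-Reasoning
  N = 2 * b + suc i
  a = b + suc i
  B = binom (suc i) b
  q = quotient (b+i∣[2b+i]*binom b (suc i))
  N*B≡q*a : N * B ≡ q * a
  N*B≡q*a = m∣n⇒n≡quotient*m (b+i∣[2b+i]*binom b (suc i))
  N+i≡a*2 : N + suc i ≡ a * 2
  N+i≡a*2 = double b i
    where
    double : ∀ b i → 2 * b + suc i + suc i ≡ (b + suc i) * 2
    double = solve-∀
  instance _ = >-nonZero (<-≤-trans z<s (m≤n+m (suc i) N))
  coeff≡q : coeff N (suc i) ≡ q
  coeff≡q = begin
    div (2 * N * (((N + suc i) / 2) C ((N ∸ suc i) / 2))) (N + suc i)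
      ≡⟨ cong (λ z → div (2 * N * z) (N + suc i)) (cong₂ _C_ half-sum half-difference) ⟩
    div (2 * N * (a C b)) (N + suc i)
      ≡⟨ cong (λ z → div (2 * N * z) (N + suc i)) ([y+x]Cy≡binom (suc i) b) ⟩
    div (2 * N * B) (N + suc i)
      ≡⟨ cong (λ z → div z (N + suc i)) 2NB≡q*[N+i] ⟩
    div (q * (N + suc i)) (N + suc i)
      ≡⟨ div-*-cancelʳ q (N + suc i) ⟩
    q ∎
    where
    half-sum : (N + suc i) / 2 ≡ a
    half-sum = trans (cong (_/ 2) N+i≡a*2) (m*n/n≡m a 2)
    half-difference : (N ∸ suc i) / 2 ≡ b
    half-difference = trans (cong (_/ 2) (trans (m+n∸n≡m (2 * b) (suc i)) (*-comm 2 b))) (m*n/n≡m b 2)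
    2NB≡q*[N+i] : 2 * N * B ≡ q * (N + suc i)
    2NB≡q*[N+i] = begin
      2 * N * B     ≡⟨ *-assoc 2 N B ⟩
      2 * (N * B)   ≡⟨ cong (2 *_) N*B≡q*a ⟩
      2 * (q * a)   ≡⟨ *-comm 2 (q * a) ⟩
      q * a * 2     ≡⟨ *-assoc q a 2 ⟩
      q * (a * 2)   ≡⟨ cong (q *_) N+i≡a*2 ⟨
      q * (N + suc i) ∎

coeff*i≡N*binom : ∀ b i → coeff (2 * b + suc i) (suc i) * suc i ≡ (2 * b + suc i) * binom i b
coeff*i≡N*binom b i = *-cancelʳ-≡ (cᵢ * suc i) (N * binom i b) (b + suc i) (begin
  cᵢ * suc i * (b + suc i)                ≡⟨ *-comm-middle cᵢ (suc i) (b + suc i) ⟩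
  cᵢ * (b + suc i) * suc i                ≡⟨ cong (_* suc i) (coeff*[b+i]≡N*binom b i) ⟩
  N * binom (suc i) b * suc i             ≡⟨ *-comm-middle N (binom (suc i) b) (suc i) ⟩
  N * suc i * binom (suc i) b             ≡⟨ *-assoc N (suc i) (binom (suc i) b) ⟩
  N * (suc i * binom (suc i) b)           ≡⟨ cong (N *_) (binom-absorbˡ i b) ⟩
  N * (suc (b + i) * binom i b)           ≡⟨ collect N b i (binom i b) ⟩
  N * binom i b * (b + suc i)             ∎)
  where
  open ≡-Reasoning
  N = 2 * b + suc i
  cᵢ = coeff N (suc i)
  instance _ = >-nonZero (<-≤-trans z<s (m≤n+m (suc i) b))
  *-comm-middle : ∀ x y z → x * y * z ≡ x * z * y
  *-comm-middle = solve-∀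
  collect : ∀ N b i B → N * (suc (b + i) * B) ≡ N * B * (b + suc i)
  collect = solve-∀

Odd-* : ∀ {m n} → Odd m → Odd n → Odd (m * n)
Odd-* (j , refl) (k , refl) = 2 * j * k + j + k , expand j k
  where
  expand : ∀ j k → (2 * j + 1) * (2 * k + 1) ≡ 2 * (2 * j * k + j + k) + 1
  expand = solve-∀

Odd-^ : ∀ {m} → Odd m → ∀ k → Odd (m ^ k)
Odd-^ odd zero    = 0 , refl
Odd-^ odd (suc k) = Odd-* odd (Odd-^ odd k)

Odd-gap : ∀ {m n} → Odd m → Odd n → n ≤ m → Σ ℕ λ b → m ≡ 2 * b + n
Odd-gap (j , refl) (k , refl) n≤m = j ∸ k , (begin
  2 * j + 1               ≡⟨ cong (λ z → 2 * z + 1) (m∸n+n≡m k≤j) ⟨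
  2 * (j ∸ k + k) + 1     ≡⟨ regroup (j ∸ k) k ⟩
  2 * (j ∸ k) + (2 * k + 1) ∎)
  where
  open ≡-Reasoning
  k≤j : k ≤ j
  k≤j = *-cancelˡ-≤ 2 (+-cancelʳ-≤ 1 (2 * k) (2 * j) n≤m)
  regroup : ∀ d k → 2 * (d + k) + 1 ≡ 2 * d + (2 * k + 1)
  regroup = solve-∀

^-cancelˡ-≤ : ∀ {m a b} → 1 < m → m ^ a ≤ m ^ b → a ≤ b
^-cancelˡ-≤ {m} 1<m mᵃ≤mᵇ = ≮⇒≥ (λ b<a → <⇒≱ (^-monoʳ-< m 1<m b<a) mᵃ≤mᵇ)

^-cancelˡ-< : ∀ {m a b} → 1 < m → m ^ a < m ^ b → a < b
^-cancelˡ-< {m@(suc _)} 1<m mᵃ<mᵇ = ≰⇒> (λ b≤a → <⇒≱ mᵃ<mᵇ (^-monoʳ-≤ m b≤a))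

^-monoʳ-∣ : ∀ m {a b} → a ≤ b → m ^ a ∣ m ^ b
^-monoʳ-∣ m {b = b} z≤n     = 1∣ (m ^ b)
^-monoʳ-∣ m         (s≤s a≤b) = *-monoʳ-∣ m (^-monoʳ-∣ m a≤b)

module Valuation {ℓ : ℕ} (ℓ-prime : Prime ℓ) where

  instance
    ℓ-nonTrivial : NonTrivial ℓ
    ℓ-nonTrivial = prime⇒nonTrivial ℓ-prime

    ℓ-nonZero : NonZero ℓ
    ℓ-nonZero = nonTrivial⇒nonZero ℓ

  1<ℓ : 1 < ℓ
  1<ℓ = nonTrivial⇒n>1 ℓ

  ℓ∤1 : ¬ ℓ ∣ 1
  ℓ∤1 ℓ∣1 = <⇒≢ 1<ℓ (sym (∣1⇒≡1 ℓ∣1))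

  ℓ∤⇒nonZero : ∀ {u} → ¬ ℓ ∣ u → NonZero u
  ℓ∤⇒nonZero {zero}  ℓ∤0 = ⊥-elim (ℓ∤0 (ℓ ∣0))
  ℓ∤⇒nonZero {suc u} _   = _

  ℓ∤-* : ∀ {u w} → ¬ ℓ ∣ u → ¬ ℓ ∣ w → ¬ ℓ ∣ u * w
  ℓ∤-* {u} {w} ℓ∤u ℓ∤w ℓ∣uw with euclidsLemma u w ℓ-prime ℓ∣uw
  ... | inj₁ ℓ∣u = ℓ∤u ℓ∣u
  ... | inj₂ ℓ∣w = ℓ∤w ℓ∣w

  ℓ∣ℓ^[1+e]*u : ∀ e u → ℓ ∣ ℓ ^ suc e * u
  ℓ∣ℓ^[1+e]*u e u = ∣m⇒∣m*n u (m∣m*n (ℓ ^ e))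

  ℓ^e*u≡ℓ^f*w⇒e≡f : ∀ e f {u w} → ¬ ℓ ∣ u → ¬ ℓ ∣ w → ℓ ^ e * u ≡ ℓ ^ f * w → e ≡ f
  ℓ^e*u≡ℓ^f*w⇒e≡f zero    zero    _   _   _  = refl
  ℓ^e*u≡ℓ^f*w⇒e≡f zero    (suc f) ℓ∤u _   eq =
    ⊥-elim (ℓ∤u (subst (ℓ ∣_) (trans (sym eq) (*-identityˡ _)) (ℓ∣ℓ^[1+e]*u f _)))
  ℓ^e*u≡ℓ^f*w⇒e≡f (suc e) zero    _   ℓ∤w eq =
    ⊥-elim (ℓ∤w (subst (ℓ ∣_) (trans eq (*-identityˡ _)) (ℓ∣ℓ^[1+e]*u e _)))
  ℓ^e*u≡ℓ^f*w⇒e≡f (suc e) (suc f) {u} {w} ℓ∤u ℓ∤w eq = cong suc (ℓ^e*u≡ℓ^f*w⇒e≡f e f ℓ∤u ℓ∤w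
    (*-cancelˡ-≡ (ℓ ^ e * u) (ℓ ^ f * w) ℓ (trans (sym (*-assoc ℓ (ℓ ^ e) u)) (trans eq (*-assoc ℓ (ℓ ^ f) w)))))

  νAux-spec : ∀ f k .{{_ : NonZero k}} → k ≤ f → Σ ℕ λ u → k ≡ ℓ ^ νAux f ℓ k * u × ¬ ℓ ∣ u
  νAux-spec zero    .zero z≤n = ⊥-elim (≢-nonZero⁻¹ 0 refl)
  νAux-spec (suc f) k     k≤f with ℓ ∣? k
  ... | no ℓ∤k = k , sym (*-identityˡ k) , ℓ∤k
  ... | yes ℓ∣k@(divides q k≡q*ℓ) with νAux-spec f q {{quotient≢0 ℓ∣k}} (s≤s⁻¹ (<-≤-trans (quotient-< ℓ∣k) k≤f))
  ...   | u , q≡ℓ^t*u , ℓ∤u = u , trans k≡q*ℓ (trans (cong (_* ℓ) q≡ℓ^t*u) (*-comm-assoc (ℓ ^ νAux f ℓ q) u ℓ)) , ℓ∤u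
    where
    *-comm-assoc : ∀ x y z → x * y * z ≡ z * x * y
    *-comm-assoc = solve-∀

  ν-spec : ∀ k .{{_ : NonZero k}} → Σ ℕ λ u → k ≡ ℓ ^ ν ℓ k * u × ¬ ℓ ∣ u
  ν-spec k = νAux-spec k k ≤-refl

  ν-unique : ∀ e {u} → ¬ ℓ ∣ u → ν ℓ (ℓ ^ e * u) ≡ e
  ν-unique e {u} ℓ∤u =
    let instance _ = m*n≢0 (ℓ ^ e) u {{m^n≢0 ℓ e}} {{ℓ∤⇒nonZero ℓ∤u}}
        w , eq , ℓ∤w = ν-spec (ℓ ^ e * u)
    in sym (ℓ^e*u≡ℓ^f*w⇒e≡f e _ ℓ∤u ℓ∤w eq)

  ν-* : ∀ x y .{{_ : NonZero x}} .{{_ : NonZero y}} → ν ℓ (x * y) ≡ ν ℓ x + ν ℓ y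
  ν-* x y with ν-spec x | ν-spec y
  ... | u , x≡ , ℓ∤u | w , y≡ , ℓ∤w = trans (cong (ν ℓ) x*y≡) (ν-unique (ν ℓ x + ν ℓ y) (ℓ∤-* ℓ∤u ℓ∤w))
    where
    open ≡-Reasoning
    x*y≡ : x * y ≡ ℓ ^ (ν ℓ x + ν ℓ y) * (u * w)
    x*y≡ = begin
      x * y                               ≡⟨ cong₂ _*_ x≡ y≡ ⟩
      ℓ ^ ν ℓ x * u * (ℓ ^ ν ℓ y * w)     ≡⟨ [m*n]*[o*p]≡[m*o]*[n*p] (ℓ ^ ν ℓ x) u (ℓ ^ ν ℓ y) w ⟩
      ℓ ^ ν ℓ x * ℓ ^ ν ℓ y * (u * w)     ≡⟨ cong (_* (u * w)) (^-distribˡ-+-* ℓ (ν ℓ x) (ν ℓ y)) ⟨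
      ℓ ^ (ν ℓ x + ν ℓ y) * (u * w)       ∎

  ν-^ : ∀ m → ν ℓ (ℓ ^ m) ≡ m
  ν-^ m = subst (λ k → ν ℓ k ≡ m) (*-identityʳ (ℓ ^ m)) (ν-unique m ℓ∤1)

  ℓ^ν∣ : ∀ k → ℓ ^ ν ℓ k ∣ k
  ℓ^ν∣ zero    = 1 ∣0
  ℓ^ν∣ (suc k) = let u , eq , _ = ν-spec (suc k) in divides u (trans eq (*-comm _ u))

  ℓ^ν≤ : ∀ k .{{_ : NonZero k}} → ℓ ^ ν ℓ k ≤ k
  ℓ^ν≤ k = ∣⇒≤ (ℓ^ν∣ k)

  ν≤ : ∀ {k m} .{{_ : NonZero k}} → k ≤ ℓ ^ m → ν ℓ k ≤ m
  ν≤ {k} k≤ℓ^m = ^-cancelˡ-≤ 1<ℓ (≤-trans (ℓ^ν≤ k) k≤ℓ^m)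

  ν< : ∀ {k m} .{{_ : NonZero k}} → k < ℓ ^ m → ν ℓ k < m
  ν< {k} k<ℓ^m = ^-cancelˡ-< 1<ℓ (≤-<-trans (ℓ^ν≤ k) k<ℓ^m)

  ν-+ : ∀ {j} B .{{_ : NonZero j}} → ℓ ^ suc (ν ℓ j) ∣ B → ν ℓ (B + j) ≡ ν ℓ j
  ν-+ {j} B (divides q B≡q*ℓ^[1+t]) with ν-spec j
  ... | u , j≡ℓ^t*u , ℓ∤u = trans (cong (ν ℓ) B+j≡) (ν-unique t ℓ∤qℓ+u)
    where
    t = ν ℓ j
    B+j≡ : B + j ≡ ℓ ^ t * (q * ℓ + u)
    B+j≡ = trans (cong₂ _+_ B≡q*ℓ^[1+t] j≡ℓ^t*u) (factor q ℓ (ℓ ^ t) u)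
      where
      factor : ∀ q ℓ T u → q * (ℓ * T) + T * u ≡ T * (q * ℓ + u)
      factor = solve-∀
    ℓ∤qℓ+u : ¬ ℓ ∣ q * ℓ + u
    ℓ∤qℓ+u ℓ∣qℓ+u = ℓ∤u (∣m+n∣m⇒∣n ℓ∣qℓ+u (n∣m*n q))

  ν-binom≡0 : ∀ {m B} → ℓ ^ m ∣ B → ∀ s → s < ℓ ^ m → ν ℓ (binom s B) ≡ 0
  ν-binom≡0 _ zero _ = ν-^ 0
  ν-binom≡0 {m} {B} ℓ^m∣B (suc s) 1+s<ℓ^m = +-cancelˡ-≡ (ν ℓ (suc s)) (ν ℓ (binom (suc s) B)) 0 (begin
    ν ℓ (suc s) + ν ℓ (binom (suc s) B)   ≡⟨ ν-* (suc s) (binom (suc s) B) ⟨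
    ν ℓ (suc s * binom (suc s) B)         ≡⟨ cong (ν ℓ) (binom-absorbˡ s B) ⟩
    ν ℓ (suc (B + s) * binom s B)         ≡⟨ ν-* (suc (B + s)) (binom s B) ⟩
    ν ℓ (suc (B + s)) + ν ℓ (binom s B)   ≡⟨ cong₂ _+_ ν[1+B+s]≡ν[1+s] (ν-binom≡0 {m} ℓ^m∣B s (<-trans (n<1+n s) 1+s<ℓ^m)) ⟩
    ν ℓ (suc s) + 0                       ∎)
    where
    open ≡-Reasoning
    instance
      _ = binom-nonZero (suc s) B
      _ = binom-nonZero s B
    ν[1+B+s]≡ν[1+s] : ν ℓ (suc (B + s)) ≡ ν ℓ (suc s)
    ν[1+B+s]≡ν[1+s] = trans (cong (ν ℓ) (sym (+-suc B s))) (ν-+ B (∣-trans (^-monoʳ-∣ ℓ (ν< {m = m} 1+s<ℓ^m)) ℓ^m∣B))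

1+d*e≤[1+e]^d : ∀ e d → 1 + d * e ≤ suc e ^ d
1+d*e≤[1+e]^d e zero    = ≤-refl
1+d*e≤[1+e]^d e (suc d) = begin
  1 + (e + d * e)               ≡⟨ regroup e d ⟩
  (1 + d * e) + e * 1           ≤⟨ +-mono-≤ (1+d*e≤[1+e]^d e d) (*-monoʳ-≤ e (m^n>0 (suc e) d)) ⟩
  suc e ^ d + e * suc e ^ d     ∎
  where
  open ≤-Reasoning
  regroup : ∀ e d → 1 + (e + d * e) ≡ (1 + d * e) + e * 1
  regroup = solve-∀

-- (i , v) lies on or above the line of slope −1/(e · (1+e)ʲ) through ((1+e)ʲ , K).
chord-bound : ∀ {e} → 1 ≤ e → ∀ {j K v t i} → K + j ≤ v + t → suc e ^ t ≤ i →
              suc e ^ j + K * (e * suc e ^ j) ≤ i + v * (e * suc e ^ j)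
chord-bound {e} 1≤e {j} {K} {v} {t} {i} K+j≤v+t [1+e]ᵗ≤i with <-cmp t j
... | tri< t<j _ _ = begin
  A + K * L     ≤⟨ +-monoˡ-≤ (K * L) (m≤n*m A e {{>-nonZero 1≤e}}) ⟩
  suc K * L     ≤⟨ *-monoˡ-≤ L K<v ⟩
  v * L         ≤⟨ m≤n+m (v * L) i ⟩
  i + v * L     ∎
  where
  open ≤-Reasoning
  A = suc e ^ j
  L = e * A
  K<v : K < v
  K<v = +-cancelʳ-< j K v (≤-<-trans K+j≤v+t (+-monoʳ-< v t<j))
... | tri≈ _ refl _ = +-mono-≤ [1+e]ᵗ≤i (*-monoˡ-≤ (e * suc e ^ t) (+-cancelʳ-≤ t K v K+j≤v+t))
... | tri> _ _ j<t = begin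
  A + K * L               ≤⟨ +-monoʳ-≤ A (*-monoˡ-≤ L K≤v+d) ⟩
  A + (v + d) * L         ≡⟨ regroup A v d L ⟩
  A + d * L + v * L       ≤⟨ +-monoˡ-≤ (v * L) A+dL≤i ⟩
  i + v * L               ∎
  where
  open ≤-Reasoning
  A = suc e ^ j
  L = e * A
  d = t ∸ j
  t≡j+d : t ≡ j + d
  t≡j+d = sym (m+[n∸m]≡n (<⇒≤ j<t))
  K≤v+d : K ≤ v + d
  K≤v+d = +-cancelʳ-≤ j K (v + d) (≤-trans K+j≤v+t (≤-reflexive (trans (cong (v +_) t≡j+d) (shift v j d))))
    where
    shift : ∀ v j d → v + (j + d) ≡ v + d + j
    shift = solve-∀
  regroup : ∀ A v d L → A + (v + d) * L ≡ A + d * L + v * L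
  regroup = solve-∀
  A+dL≤i : A + d * L ≤ i
  A+dL≤i = begin
    A + d * (e * A)   ≡⟨ factor A d e ⟩
    A * (1 + d * e)   ≤⟨ *-monoʳ-≤ A (1+d*e≤[1+e]^d e d) ⟩
    A * suc e ^ d     ≡⟨ ^-distribˡ-+-* (suc e) j d ⟨
    suc e ^ (j + d)   ≡⟨ cong (suc e ^_) t≡j+d ⟨
    suc e ^ t         ≤⟨ [1+e]ᵗ≤i ⟩
    i                 ∎
    where
    factor : ∀ A d e → A + d * (e * A) ≡ A * (1 + d * e)
    factor = solve-∀

aboveLine-descent : ∀ A L K i v → A + suc K * L ≤ i + v * L → AboveLine A (suc K) (A + L) K i v
aboveLine-descent A L K i v h = begin
  (+ K ℤ.- + suc K) ℤ.* (+ i ℤ.- + A)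
    ≡⟨ rearrange (+ A) (+ L) (+ K) (+ i) (+ v) ⟩
  (+ A ℤ.+ + suc K ℤ.* + L) ℤ.+ (R ℤ.- (+ i ℤ.+ + v ℤ.* + L))
    ≡⟨ cong₂ (λ p q → (+ A ℤ.+ p) ℤ.+ (R ℤ.- (+ i ℤ.+ q))) (ℤₚ.pos-* (suc K) L) (ℤₚ.pos-* v L) ⟨
  + (A + suc K * L) ℤ.+ (R ℤ.- + (i + v * L))
    ≤⟨ ℤₚ.+-monoˡ-≤ (R ℤ.- + (i + v * L)) (ℤ.+≤+ h) ⟩
  + (i + v * L) ℤ.+ (R ℤ.- + (i + v * L))
    ≡⟨ cancel (+ (i + v * L)) R ⟩
  R ∎
  where
  open ℤ using (+_)
  open ℤₚ.≤-Reasoning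
  R = (+ v ℤ.- + suc K) ℤ.* (+ (A + L) ℤ.- + A)
  rearrange : ∀ A L K i v → (K ℤ.- (+ 1 ℤ.+ K)) ℤ.* (i ℤ.- A) ≡
              (A ℤ.+ (+ 1 ℤ.+ K) ℤ.* L) ℤ.+ ((v ℤ.- (+ 1 ℤ.+ K)) ℤ.* ((A ℤ.+ L) ℤ.- A) ℤ.- (i ℤ.+ v ℤ.* L))
  rearrange = ℤ-solve-∀
  cancel : ∀ x y → x ℤ.+ (y ℤ.- x) ≡ y
  cancel = ℤ-solve-∀

aboveChord : ∀ {ℓ} → 1 < ℓ → ∀ {j K v t i} → suc K + j ≤ v + t → ℓ ^ t ≤ i →
             AboveLine (ℓ ^ j) (suc K) (ℓ ^ suc j) K i v
aboveChord {suc e} (s≤s 1≤e) {j} {K} {v} {t} {i} h ℓᵗ≤i =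
  aboveLine-descent (suc e ^ j) (e * suc e ^ j) K i v (chord-bound 1≤e {j} {suc K} {v} {t} {i} h ℓᵗ≤i)

module ChebyshevCoefficients {ℓ : ℕ} (ℓ-prime : Prime ℓ) (ℓ-odd : Odd ℓ) (n : ℕ) where

  open Valuation ℓ-prime

  Admissible : ℕ → Set
  Admissible i = Odd i × 1 ≤ i × i ≤ ℓ ^ n

  ν[cᵢ]+ν[i]≡n+ν[binom] : ∀ {b i} .{{_ : NonZero i}} → ℓ ^ n ≡ 2 * b + i →
                          ν ℓ (c ℓ n i) + ν ℓ i ≡ n + ν ℓ (binom (pred i) b)
  ν[cᵢ]+ν[i]≡n+ν[binom] {b} {suc i} ℓⁿ≡2b+i = begin
    ν ℓ cᵢ + ν ℓ (suc i)            ≡⟨ ν-* cᵢ (suc i) ⟨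
    ν ℓ (cᵢ * suc i)                ≡⟨ cong (ν ℓ) cᵢ*i≡ℓⁿ*binom ⟩
    ν ℓ (ℓ ^ n * binom i b)         ≡⟨ ν-* (ℓ ^ n) (binom i b) ⟩
    ν ℓ (ℓ ^ n) + ν ℓ (binom i b)   ≡⟨ cong (_+ ν ℓ (binom i b)) (ν-^ n) ⟩
    n + ν ℓ (binom i b)             ∎
    where
    open ≡-Reasoning
    cᵢ = c ℓ n (suc i)
    cᵢ*i≡ℓⁿ*binom : cᵢ * suc i ≡ ℓ ^ n * binom i b
    cᵢ*i≡ℓⁿ*binom = subst (λ N → coeff N (suc i) * suc i ≡ N * binom i b) (sym ℓⁿ≡2b+i) (coeff*i≡N*binom b i)
    instance
      _ = m^n≢0 ℓ n
      _ = binom-nonZero i b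
      _ = m*n≢0⇒m≢0 cᵢ {{subst NonZero (sym cᵢ*i≡ℓⁿ*binom) (m*n≢0 (ℓ ^ n) (binom i b))}}

  n≤ν[cᵢ]+ν[i] : ∀ {i} → Admissible i → n ≤ ν ℓ (c ℓ n i) + ν ℓ i
  n≤ν[cᵢ]+ν[i] {i} (odd , 1≤i , i≤ℓⁿ) =
    let instance _ = >-nonZero 1≤i
        b , ℓⁿ≡2b+i = Odd-gap (Odd-^ ℓ-odd n) odd i≤ℓⁿ
    in subst (n ≤_) (sym (ν[cᵢ]+ν[i]≡n+ν[binom] {b} ℓⁿ≡2b+i)) (m≤m+n n _)

  ν[cᵢ]-bound : (m i : ℕ) → m ≤ n → Odd i → 0 < i → i ≤ ℓ ^ m →
                (n ∸ m ≤ ν ℓ (c ℓ n i)) × (ν ℓ (c ℓ n i) ≡ n ∸ m → i ≡ ℓ ^ m)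
  ν[cᵢ]-bound m i m≤n odd 0<i i≤ℓᵐ = n∸m≤ν[cᵢ] , equality-case
    where
    instance _ = >-nonZero 0<i
    lower : n ≤ ν ℓ (c ℓ n i) + ν ℓ i
    lower = n≤ν[cᵢ]+ν[i] (odd , 0<i , ≤-trans i≤ℓᵐ (^-monoʳ-≤ ℓ m≤n))
    ν[i]≤m : ν ℓ i ≤ m
    ν[i]≤m = ν≤ i≤ℓᵐ
    n∸m≤ν[cᵢ] : n ∸ m ≤ ν ℓ (c ℓ n i)
    n∸m≤ν[cᵢ] = m≤n+o⇒m∸n≤o n m (begin
      n                        ≤⟨ lower ⟩
      ν ℓ (c ℓ n i) + ν ℓ i    ≤⟨ +-monoʳ-≤ (ν ℓ (c ℓ n i)) ν[i]≤m ⟩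
      ν ℓ (c ℓ n i) + m        ≡⟨ +-comm (ν ℓ (c ℓ n i)) m ⟩
      m + ν ℓ (c ℓ n i)        ∎)
      where open ≤-Reasoning
    equality-case : ν ℓ (c ℓ n i) ≡ n ∸ m → i ≡ ℓ ^ m
    equality-case ν[cᵢ]≡n∸m = ≤-antisym i≤ℓᵐ (∣⇒≤ (subst (λ e → ℓ ^ e ∣ i) ν[i]≡m (ℓ^ν∣ i)))
      where
      m≤ν[i] : m ≤ ν ℓ i
      m≤ν[i] = +-cancelˡ-≤ (n ∸ m) m (ν ℓ i) (begin
        n ∸ m + m               ≡⟨ m∸n+n≡m m≤n ⟩
        n                       ≤⟨ lower ⟩
        ν ℓ (c ℓ n i) + ν ℓ i   ≡⟨ cong (_+ ν ℓ i) ν[cᵢ]≡n∸m ⟩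
        n ∸ m + ν ℓ i           ∎)
        where open ≤-Reasoning
      ν[i]≡m : ν ℓ i ≡ m
      ν[i]≡m = ≤-antisym ν[i]≤m m≤ν[i]

  ν[c[ℓʲ]]≡n∸j : ∀ j → j ≤ n → ν ℓ (c ℓ n (ℓ ^ j)) ≡ n ∸ j
  ν[c[ℓʲ]]≡n∸j j j≤n = trans (sym (m+n∸n≡m (ν ℓ (c ℓ n (ℓ ^ j))) j)) (cong (_∸ j) ν[c]+j≡n)
    where
    open ≡-Reasoning
    instance _ = m^n≢0 ℓ j
    r = Σ.proj₁ (Odd-^ ℓ-odd (n ∸ j))
    b = ℓ ^ j * r
    ℓⁿ≡2b+ℓʲ : ℓ ^ n ≡ 2 * b + ℓ ^ j
    ℓⁿ≡2b+ℓʲ = begin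
      ℓ ^ n                 ≡⟨ cong (ℓ ^_) (m+[n∸m]≡n j≤n) ⟨
      ℓ ^ (j + (n ∸ j))     ≡⟨ ^-distribˡ-+-* ℓ j (n ∸ j) ⟩
      ℓ ^ j * ℓ ^ (n ∸ j)   ≡⟨ cong (ℓ ^ j *_) (Σ.proj₂ (Odd-^ ℓ-odd (n ∸ j))) ⟩
      ℓ ^ j * (2 * r + 1)   ≡⟨ expand (ℓ ^ j) r ⟩
      2 * b + ℓ ^ j         ∎
      where
      expand : ∀ a r → a * (2 * r + 1) ≡ 2 * (a * r) + a
      expand = solve-∀
    ν[c]+j≡n : ν ℓ (c ℓ n (ℓ ^ j)) + j ≡ n
    ν[c]+j≡n = begin
      ν ℓ (c ℓ n (ℓ ^ j)) + j                  ≡⟨ cong (ν ℓ (c ℓ n (ℓ ^ j)) +_) (ν-^ j) ⟨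
      ν ℓ (c ℓ n (ℓ ^ j)) + ν ℓ (ℓ ^ j)        ≡⟨ ν[cᵢ]+ν[i]≡n+ν[binom] ℓⁿ≡2b+ℓʲ ⟩
      n + ν ℓ (binom (pred (ℓ ^ j)) b)         ≡⟨ cong (n +_) (ν-binom≡0 {j} (m∣m*n r) (pred (ℓ ^ j)) (≤-reflexive (suc-pred (ℓ ^ j)))) ⟩
      n + 0                                    ≡⟨ +-identityʳ n ⟩
      n                                        ∎

  aboveSegment : ∀ j → j < n → ∀ i → Admissible i →
                 AboveLine (ℓ ^ j) (n ∸ j) (ℓ ^ suc j) (n ∸ suc j) i (ν ℓ (c ℓ n i))
  aboveSegment j j<n i admissible@(_ , 1≤i , _) =
    subst (λ y → AboveLine (ℓ ^ j) y (ℓ ^ suc j) (n ∸ suc j) i (ν ℓ (c ℓ n i))) (sym n∸j≡1+n∸[1+j])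
      (aboveChord 1<ℓ {j} {n ∸ suc j} {ν ℓ (c ℓ n i)} {ν ℓ i} {i} lower (ℓ^ν≤ i))
    where
    instance _ = >-nonZero 1≤i
    n∸j≡1+n∸[1+j] : n ∸ j ≡ suc (n ∸ suc j)
    n∸j≡1+n∸[1+j] = +-∸-assoc 1 j<n
    lower : suc (n ∸ suc j) + j ≤ ν ℓ (c ℓ n i) + ν ℓ i
    lower = begin
      suc (n ∸ suc j) + j     ≡⟨ cong (_+ j) n∸j≡1+n∸[1+j] ⟨
      n ∸ j + j               ≡⟨ m∸n+n≡m (<⇒≤ j<n) ⟩
      n                       ≤⟨ n≤ν[cᵢ]+ν[i] admissible ⟩
      ν ℓ (c ℓ n i) + ν ℓ i   ∎
      where open ≤-Reasoning

  lowerHull : IsLowerHull Admissible (λ i → ν ℓ (c ℓ n i)) n (ℓ ^_) (n ∸_)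
  lowerHull = record
    { increasing = λ j _ → ^-monoʳ-< ℓ 1<ℓ (n<1+n j)
    ; vertexInD  = λ j j≤n → Odd-^ ℓ-odd j , m^n>0 ℓ j , ^-monoʳ-≤ ℓ j≤n
    ; vertexOn   = ν[c[ℓʲ]]≡n∸j
    ; leftmost   = λ _ (_ , 1≤i , _) → 1≤i
    ; rightmost  = λ _ (_ , _ , i≤ℓⁿ) → i≤ℓⁿ
    ; above      = aboveSegment
    }

proposition5p3 : (ℓ n : ℕ) → Prime ℓ → Odd ℓ → 1 ≤ n →
    ((m i : ℕ) → m ≤ n → Odd i → 0 < i → i ≤ ℓ ^ m →
       (n ∸ m ≤ ν ℓ (c ℓ n i)) × (ν ℓ (c ℓ n i) ≡ n ∸ m → i ≡ ℓ ^ m))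
    × IsLowerHull (λ i → Odd i × 1 ≤ i × i ≤ ℓ ^ n) (λ i → ν ℓ (c ℓ n i)) n (λ m → ℓ ^ m) (λ m → n ∸ m)
proposition5p3 ℓ n ℓ-prime ℓ-odd _ = ν[cᵢ]-bound , lowerHull
  where open ChebyshevCoefficients ℓ-prime ℓ-odd n
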